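{- Let $\Sigma$ be a projective plane and let $\mathcal{L}$ be a collection of $N\ge 3$ lines of $\Sigma$ such that no three lines of $\mathcal{L}$ are concurrent. Let $\mathcal{A}$ be the collection of all $(N-1)$-subsets of distinct lines of $\mathcal{L}$. Then $(\Sigma,\mathcal{A})$ is an $(m=3;\,n=N,\,k=2,\,r=2,\,\alpha=2,\,\beta=1)$-functional repair code. Moreover, if $N>3$, it tolerates up to $N-2$ node failures: as long as at least two lines of $\mathcal{L}$ survive, any failed line of $\mathcal{L}$ can be obtained by $(2,1)$-repair from two surviving lines.
   Context: Subspaces of a projective plane $\Sigma$ are the empty set, points, lines and $\Sigma$ itself; the span $\langle X_1,\dots,X_t\rangle$ of subspaces is the smallest subspace containing them all; $\Sigma$ has (projective) dimension $m-1=2$, points have dimension $0$, lines dimension $1$. $(r,\beta)$-repair: a subspace $U'$ can be obtained from a set $\mathcal{U}$ of subspaces by $(r,\beta)$-repair if there are $r$ distinct members $U_{i_1},\dots,U_{i_r}$ of $\mathcal{U}$ and, for each $j$, a $(\beta-1)$-dimensional subspace $W_{i_j}\subseteq U_{i_j}$ such that $U'\subseteq\langle W_{i_1},\dots,W_{i_r}\rangle$ (for $\beta=1$ the $W_{i_j}$ are points). Functional repair code: an $(m;n,k,r,\alpha,\beta)$-functional repair code is a pair $(\Sigma,\mathcal{A})$ where $\Sigma$ is a projective space of dimension $m-1$ and $\mathcal{A}$ is a collection of $(n-1)$-sets of $(\alpha-1)$-dimensional subspaces of $\Sigma$ such that (Recovery) every $\mathcal{U}\in\mathcal{A}$ contains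 $k$ members whose span is $\Sigma$, and (Repair) for every $\mathcal{U}=\{U_1,\dots,U_{n-1}\}\in\mathcal{A}$ there is an $(\alpha-1)$-dimensional subspace $U_n$ obtainable from $\mathcal{U}$ by $(r,\beta)$-repair such that $\mathcal{U}\cup\{U_n\}\setminus\{U_i\}\in\mathcal{A}$ for every $i=1,\dots,n-1$. -}

module Defs where

open import Data.Nat using (ℕ; zero; suc; _∸_)
open import Data.Fin using (Fin)
open import Data.Product using (Σ; ∃; ∃-syntax; _×_; _,_)
open import Relation.Binary.PropositionalEquality using (_≡_; _≢_)
open import Relation.Nullary using (¬_)
open import Function.Definitions using (Injective)
open import Data.Vec.Functional using (updateAt)

record ProjectivePlane : Set₁ where
  field
    Point : Set
    Line  : Set
    _I_   : Point → Line → Set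
    join        : ∀ p q → p ≢ q → ∃[ l ] (p I l × q I l)
    join-unique : ∀ {p q l l'} → p ≢ q → p I l → q I l → p I l' → q I l' → l ≡ l'
    meet        : ∀ l l' → l ≢ l' → ∃[ p ] (p I l × p I l')
    meet-unique : ∀ {l l' p p'} → l ≢ l' → p I l → p I l' → p' I l → p' I l' → p ≡ p'
    quad       : Fin 4 → Point
    quad-gen   : ∀ (i j k : Fin 4) → i ≢ j → j ≢ k → i ≢ k → (l : Line) →
                 ¬ (quad i I l × quad j I l × quad k I l)

module _ (Π : ProjectivePlane) where
  open ProjectivePlane Π

  data Subspace : Set where
    ∅    : Subspace
    pt   : Point → Subspace
    ln   : Line → Subspace
    full : Subspace

  -- (projective dimension) + 1 : ∅ ↦ 0, point ↦ 1, line ↦ 2, Σ ↦ 3.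
  -- So "(d-1)-dimensional" means  rank U ≡ d.
  rank : Subspace → ℕ
  rank ∅      = 0
  rank (pt _) = 1
  rank (ln _) = 2
  rank full   = 3

  data _⊆_ : Subspace → Subspace → Set where
    ∅⊆     : ∀ {U} → ∅ ⊆ U
    pt⊆pt  : ∀ {p} → pt p ⊆ pt p
    pt⊆ln  : ∀ {p l} → p I l → pt p ⊆ ln l
    ln⊆ln  : ∀ {l} → ln l ⊆ ln l
    ⊆full  : ∀ {U} → U ⊆ full

  -- U' ⊆ ⟨ X₁ , … , X_t ⟩ : the span being the smallest subspace
  -- containing all Xⱼ, this says U' lies in every subspace containing all Xⱼ.
  _⊆Span_ : ∀ {t} → Subspace → (Fin t → Subspace) → Set
  U' ⊆Span X = ∀ S → (∀ j → X j ⊆ S) → U' ⊆ S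

  Repairable : (r β : ℕ) → ∀ {t} → Subspace → (Fin t → Subspace) → Set
  Repairable r β U' 𝒰 =
    Σ (Fin r → Fin _) λ σ → Injective _≡_ _≡_ σ ×
    Σ (Fin r → Subspace) λ W →
      (∀ j → rank (W j) ≡ β) × (∀ j → W j ⊆ 𝒰 (σ j)) × (U' ⊆Span W)

  -- An (n-1)-set of subspaces is encoded as an injective family
  -- Fin (n ∸ 1) → Subspace; a collection 𝒜 of such sets as a predicate.
  -- (m;n,k,r,α,β)-functional repair code with Σ = this plane, i.e. m = 3.
  record IsFunctionalRepairCode (n k r α β : ℕ)
           (𝒜 : (Fin (n ∸ 1) → Subspace) → Set) : Set where
    field
      members-sets : ∀ 𝒰 → 𝒜 𝒰 → Injective _≡_ _≡_ 𝒰
      members-dim  : ∀ 𝒰 → 𝒜 𝒰 → ∀ i → rank (𝒰 i) ≡ α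
      recovery : ∀ 𝒰 → 𝒜 𝒰 →
        Σ (Fin k → Fin (n ∸ 1)) λ σ → Injective _≡_ _≡_ σ ×
          (full ⊆Span (λ j → 𝒰 (σ j)))
      repair : ∀ 𝒰 → 𝒜 𝒰 →
        Σ Subspace λ Uₙ → rank Uₙ ≡ α × Repairable r β Uₙ 𝒰 ×
          (∀ i → 𝒜 (updateAt 𝒰 i (λ _ → Uₙ)))

  NoThreeConcurrent : ∀ {N} → (Fin N → Line) → Set
  NoThreeConcurrent {N} L = ∀ (a b c : Fin N) → a ≢ b → b ≢ c → a ≢ c →
    (p : Point) → ¬ (p I L a × p I L b × p I L c)

  AllSubsets : ∀ {N} → (Fin N → Line) → (Fin (N ∸ 1) → Subspace) → Set
  AllSubsets {N} L 𝒰 = Injective _≡_ _≡_ 𝒰 × (∀ i → ∃[ j ] 𝒰 i ≡ ln (L j))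

-- Two distinct lines meet in a point, so any two lines of 𝓛 span the plane
-- (recovery). A line l of 𝓛 is repaired from two other lines m, m' of 𝓛 by
-- downloading the points l ∩ m and l ∩ m': they are distinct because no three
-- lines of 𝓛 are concurrent, hence they span l. Replacing any member of an
-- (N-1)-subset by the one missing line of 𝓛 gives again an (N-1)-subset.
module Submission where

open import Defs
open import Data.Nat using (ℕ; suc; _≤_; _<_; s≤s)
open import Data.Nat.Properties using (1+n≰n)
open import Data.Fin using (Fin; zero; suc; _↑ˡ_; _≟_)
open import Data.Fin.Properties using (¬∀⟶∃¬; any?; injective⇒≤; suc-injective; ↑ˡ-injective)
open import Data.Fin.Subset using (Subset; _∈_; _∉_; ∣_∣; inside; outside)
open import Data.Vec.Base using (here; there) renaming (_∷_ to _∷ᵥ_)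
open import Data.Vec.Functional using (Vector; _∷_; []; updateAt)
open import Data.Vec.Functional.Properties using (updateAt-updates; updateAt-minimal)
open import Data.Product using (Σ; ∃; ∃-syntax; _×_; _,_; proj₁; proj₂)
open import Function.Base using (const)
open import Function.Definitions using (Injective)
open import Relation.Binary.PropositionalEquality
  using (_≡_; _≢_; refl; sym; trans; cong; subst)
open import Relation.Nullary using (¬_; yes; no; contradiction)

module _ {a} {A : Set a} {n : ℕ} (xs : Vector A n) (i : Fin n) (y : A) where

  updateAt-injective : Injective _≡_ _≡_ xs → (∀ j → xs j ≢ y) →
                       Injective _≡_ _≡_ (updateAt xs i (const y))
  updateAt-injective xs-inj y∉xs {j} {k} eq with j ≟ i | k ≟ i
  ... | yes refl | yes refl = refl
  ... | yes refl | no k≢i   = contradiction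
    (trans (sym (updateAt-minimal k i xs k≢i)) (trans (sym eq) (updateAt-updates i xs)))
    (y∉xs k)
  ... | no j≢i   | yes refl = contradiction
    (trans (sym (updateAt-minimal j i xs j≢i)) (trans eq (updateAt-updates i xs)))
    (y∉xs j)
  ... | no j≢i   | no k≢i   = xs-inj
    (trans (sym (updateAt-minimal j i xs j≢i)) (trans eq (updateAt-minimal k i xs k≢i)))

  updateAt-all : ∀ {p} {P : A → Set p} → (∀ j → P (xs j)) → P y →
                 ∀ j → P (updateAt xs i (const y) j)
  updateAt-all {P = P} Pxs Py j with j ≟ i
  ... | yes refl = subst P (sym (updateAt-updates i xs)) Py
  ... | no j≢i   = subst P (sym (updateAt-minimal j i xs j≢i)) (Pxs j)

injective⇒missesValue : ∀ {m} (g : Fin m → Fin (suc m)) → Injective _≡_ _≡_ g →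
                        ∃[ j ] ∀ i → g i ≢ j
injective⇒missesValue {m} g g-inj =
  let j , unhit = ¬∀⟶∃¬ (suc m) Hit (λ j → any? (λ i → g i ≟ j)) surjective⇒⊥
  in j , λ i gi≡j → unhit (i , gi≡j)
  where
  Hit : Fin (suc m) → Set
  Hit j = ∃[ i ] g i ≡ j

  surjective⇒⊥ : ¬ (∀ j → Hit j)
  surjective⇒⊥ hit = 1+n≰n (injective⇒≤ section-injective)
    where
    section-injective : Injective _≡_ _≡_ (λ j → proj₁ (hit j))
    section-injective {j} {k} eq =
      trans (sym (proj₂ (hit j))) (trans (cong g eq) (proj₂ (hit k)))

∣S∣≥2⇒twoDistinctMembers : ∀ {n} (S : Subset n) → 2 ≤ ∣ S ∣ →
                           ∃[ a ] ∃[ b ] a ∈ S × b ∈ S × a ≢ b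
∣S∣≥2⇒twoDistinctMembers (inside ∷ᵥ S) (s≤s 1≤∣S∣) =
  let b , b∈S = member S 1≤∣S∣ in zero , suc b , here , there b∈S , λ ()
  where
  member : ∀ {n} (S : Subset n) → 1 ≤ ∣ S ∣ → ∃[ a ] a ∈ S
  member (inside ∷ᵥ S)  _       = zero , here
  member (outside ∷ᵥ S) 1≤∣S∣ = let a , a∈S = member S 1≤∣S∣ in suc a , there a∈S
∣S∣≥2⇒twoDistinctMembers (outside ∷ᵥ S) 2≤∣S∣ =
  let a , b , a∈S , b∈S , a≢b = ∣S∣≥2⇒twoDistinctMembers S 2≤∣S∣
  in suc a , suc b , there a∈S , there b∈S , λ eq → a≢b (suc-injective eq)

module _ (Π : ProjectivePlane) where
  open ProjectivePlane Π

  ln-injective : ∀ {l l'} → ln {Π} l ≡ ln l' → l ≡ l'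
  ln-injective refl = refl

  full⊆Span-twoLines : ∀ {l l'} → l ≢ l' → (X : Fin 2 → Subspace Π) →
                       X zero ≡ ln l → X (suc zero) ≡ ln l' → _⊆Span_ Π full X
  full⊆Span-twoLines {l} {l'} l≢l' X X₀≡l X₁≡l' S X⊆S =
    lines⊆⇒full⊆ (subst (λ U → _⊆_ Π U S) X₀≡l (X⊆S zero))
                 (subst (λ U → _⊆_ Π U S) X₁≡l' (X⊆S (suc zero)))
    where
    lines⊆⇒full⊆ : ∀ {S} → _⊆_ Π (ln l) S → _⊆_ Π (ln l') S → _⊆_ Π full S
    lines⊆⇒full⊆ ⊆full _     = ⊆full
    lines⊆⇒full⊆ ln⊆ln ln⊆ln = contradiction refl l≢l'

  line⊆Span-twoPoints : ∀ {p q l} → p ≢ q → p I l → q I l →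
                        _⊆Span_ Π (ln l) (pt p ∷ pt q ∷ [])
  line⊆Span-twoPoints {p} {q} {l} p≢q p∈l q∈l S W⊆S =
    points⊆⇒line⊆ (W⊆S zero) (W⊆S (suc zero))
    where
    points⊆⇒line⊆ : ∀ {S} → _⊆_ Π (pt p) S → _⊆_ Π (pt q) S → _⊆_ Π (ln l) S
    points⊆⇒line⊆ pt⊆pt        pt⊆pt        = contradiction refl p≢q
    points⊆⇒line⊆ (pt⊆ln p∈l') (pt⊆ln q∈l')
      with refl ← join-unique p≢q p∈l q∈l p∈l' q∈l' = ln⊆ln
    points⊆⇒line⊆ ⊆full        _            = ⊆full

  line-repairable : ∀ {t l p q} (𝒰 : Fin t → Subspace Π) (σ : Fin 2 → Fin t) →
                    Injective _≡_ _≡_ σ → p ≢ q → p I l → q I l →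
                    _⊆_ Π (pt p) (𝒰 (σ zero)) → _⊆_ Π (pt q) (𝒰 (σ (suc zero))) →
                    Repairable Π 2 1 (ln l) 𝒰
  line-repairable 𝒰 σ σ-inj p≢q p∈l q∈l p∈𝒰₀ q∈𝒰₁ =
    σ , σ-inj , pt _ ∷ pt _ ∷ [] ,
    (λ { zero → refl ; (suc zero) → refl }) ,
    (λ { zero → p∈𝒰₀ ; (suc zero) → q∈𝒰₁ }) ,
    line⊆Span-twoPoints p≢q p∈l q∈l

  module _ {N} (L : Fin N → Line) (L-inj : Injective _≡_ _≡_ L)
           (no3 : NoThreeConcurrent Π L) where

    line-repairable-fromTwoOthers :
      ∀ {t x y z} → x ≢ y → y ≢ z → x ≢ z →
      (𝒰 : Fin t → Subspace Π) (σ : Fin 2 → Fin t) → Injective _≡_ _≡_ σ →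
      𝒰 (σ zero) ≡ ln (L y) → 𝒰 (σ (suc zero)) ≡ ln (L z) →
      Repairable Π 2 1 (ln (L x)) 𝒰
    line-repairable-fromTwoOthers {x = x} {y} {z} x≢y y≢z x≢z 𝒰 σ σ-inj 𝒰₀≡y 𝒰₁≡z
      with meet (L x) (L y) (λ eq → x≢y (L-inj eq)) | meet (L x) (L z) (λ eq → x≢z (L-inj eq))
    ... | p , p∈x , p∈y | q , q∈x , q∈z =
      line-repairable 𝒰 σ σ-inj p≢q p∈x q∈x
        (subst (_⊆_ Π (pt p)) (sym 𝒰₀≡y) (pt⊆ln p∈y))
        (subst (_⊆_ Π (pt q)) (sym 𝒰₁≡z) (pt⊆ln q∈z))
      where
      p≢q : p ≢ q
      p≢q refl = no3 x y z x≢y y≢z x≢z p (p∈x , p∈y , q∈z)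

    lostLine-repairableFromSurvivors :
      (S : Subset N) → 2 ≤ ∣ S ∣ → (f : Fin N) → f ∉ S →
      ∃[ a ] ∃[ b ] a ∈ S × b ∈ S × a ≢ b ×
        Repairable Π 2 1 (ln (L f)) (ln (L a) ∷ ln (L b) ∷ [])
    lostLine-repairableFromSurvivors S 2≤∣S∣ f f∉S
      with a , b , a∈S , b∈S , a≢b ← ∣S∣≥2⇒twoDistinctMembers S 2≤∣S∣ =
      a , b , a∈S , b∈S , a≢b ,
      line-repairable-fromTwoOthers (λ { refl → f∉S a∈S }) a≢b (λ { refl → f∉S b∈S })
        (ln (L a) ∷ ln (L b) ∷ []) (λ i → i) (λ eq → eq) refl refl

  AllSubsets-missingLine : ∀ {n} {L : Fin (suc n) → Line} → Injective _≡_ _≡_ L →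
                           ∀ {𝒰} → AllSubsets Π L 𝒰 → ∃[ j ] ∀ i → 𝒰 i ≢ ln (L j)
  AllSubsets-missingLine {L = L} L-inj {𝒰} (𝒰-inj , 𝒰⊆L) =
    let j , j-missed = injective⇒missesValue index index-injective
    in j , λ i 𝒰ᵢ≡j → j-missed i (L-inj (ln-injective (trans (sym (proj₂ (𝒰⊆L i))) 𝒰ᵢ≡j)))
    where
    index = λ i → proj₁ (𝒰⊆L i)

    index-injective : Injective _≡_ _≡_ index
    index-injective {i} {i'} eq =
      𝒰-inj (trans (proj₂ (𝒰⊆L i)) (trans (cong (λ j → ln (L j)) eq) (sym (proj₂ (𝒰⊆L i')))))

  AllSubsets-replace : ∀ {N} {L : Fin N → Line} {𝒰 j} → AllSubsets Π L 𝒰 →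
                       (∀ i → 𝒰 i ≢ ln (L j)) →
                       ∀ i → AllSubsets Π L (updateAt 𝒰 i (const (ln (L j))))
  AllSubsets-replace {L = L} {j = j} (𝒰-inj , 𝒰⊆L) j-new i =
    updateAt-injective _ i _ 𝒰-inj j-new ,
    updateAt-all _ i _ {P = λ U → ∃[ j' ] U ≡ ln (L j')} 𝒰⊆L (j , refl)

  AllSubsets-isFunctionalRepairCode :
    ∀ {k} (L : Fin (suc (suc (suc k))) → Line) → Injective _≡_ _≡_ L →
    NoThreeConcurrent Π L → IsFunctionalRepairCode Π (suc (suc (suc k))) 2 2 2 1 (AllSubsets Π L)
  AllSubsets-isFunctionalRepairCode {k} L L-inj no3 = record
    { members-sets = λ _ → proj₁
    ; members-dim  = λ _ (_ , 𝒰⊆L) i → cong (rank Π) (proj₂ (𝒰⊆L i))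
    ; recovery     = recovery
    ; repair       = repair
    }
    where
    first-two : Fin 2 → Fin (suc (suc k))
    first-two = _↑ˡ k

    first-two-injective : Injective _≡_ _≡_ first-two
    first-two-injective = ↑ˡ-injective k _ _

    first-two-distinctLines : ∀ {𝒰 l l'} → Injective _≡_ _≡_ 𝒰 →
                              𝒰 zero ≡ ln l → 𝒰 (suc zero) ≡ ln l' → l ≢ l'
    first-two-distinctLines 𝒰-inj 𝒰₀≡l 𝒰₁≡l' refl with () ← 𝒰-inj (trans 𝒰₀≡l (sym 𝒰₁≡l'))

    recovery : ∀ 𝒰 → AllSubsets Π L 𝒰 →
               Σ (Fin 2 → Fin (suc (suc k))) λ σ → Injective _≡_ _≡_ σ ×
                 _⊆Span_ Π full (λ j → 𝒰 (σ j))
    recovery 𝒰 (𝒰-inj , 𝒰⊆L)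
      with y , 𝒰₀≡y ← 𝒰⊆L zero
         | z , 𝒰₁≡z ← 𝒰⊆L (suc zero) =
      first-two , first-two-injective ,
      full⊆Span-twoLines (first-two-distinctLines 𝒰-inj 𝒰₀≡y 𝒰₁≡z) _ 𝒰₀≡y 𝒰₁≡z

    repair : ∀ 𝒰 → AllSubsets Π L 𝒰 →
             Σ (Subspace Π) λ Uₙ → rank Π Uₙ ≡ 2 × Repairable Π 2 1 Uₙ 𝒰 ×
               (∀ i → AllSubsets Π L (updateAt 𝒰 i (λ _ → Uₙ)))
    repair 𝒰 𝒰∈𝒜@(𝒰-inj , 𝒰⊆L)
      with j , j-new ← AllSubsets-missingLine L-inj 𝒰∈𝒜
         | y , 𝒰₀≡y ← 𝒰⊆L zero
         | z , 𝒰₁≡z ← 𝒰⊆L (suc zero) =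
      ln (L j) , refl ,
      line-repairable-fromTwoOthers L L-inj no3
        (λ { refl → j-new zero 𝒰₀≡y })
        (λ y≡z → first-two-distinctLines 𝒰-inj 𝒰₀≡y 𝒰₁≡z (cong L y≡z))
        (λ { refl → j-new (suc zero) 𝒰₁≡z })
        𝒰 first-two first-two-injective 𝒰₀≡y 𝒰₁≡z ,
      AllSubsets-replace 𝒰∈𝒜 j-new

mainTheorem1 : (Π : ProjectivePlane) (N : ℕ) → 3 ≤ N →
  (L : Fin N → ProjectivePlane.Line Π) → Injective _≡_ _≡_ L →
  NoThreeConcurrent Π L →
  IsFunctionalRepairCode Π N 2 2 2 1 (AllSubsets Π L)
  × (3 < N → (S : Subset N) → 2 ≤ ∣ S ∣ → (f : Fin N) → f ∉ S →
      Σ (Fin N) λ a → Σ (Fin N) λ b → a ∈ S × b ∈ S × a ≢ b ×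
        Repairable Π 2 1 (ln (L f)) (ln (L a) ∷ ln (L b) ∷ []))
mainTheorem1 Π (suc (suc (suc k))) (s≤s (s≤s (s≤s _))) L L-inj no3 =
  AllSubsets-isFunctionalRepairCode Π L L-inj no3 ,
  λ _ → lostLine-repairableFromSurvivors Π L L-inj no3
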